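{- Let $\mathcal{M}$ be a matroid on a finite totally ordered set $E$ with rank function $\rk$ and set of bases $\mathcal{B}$. Then $$Z_\mathcal{M}(q,\mathbf{v})=q^{ -\rk(E)}\sum_{B\in\mathcal{B}}\prod_{b\in B}v_b\prod_{e\in E(B)}(v_e+1)\prod_{i\in I(B)}\Big(\frac{q}{v_i}+1\Big).$$
   Context: $Z_\mathcal{M}(q,\mathbf{v})=\sum_{A\subseteq E}q^{ -\rk(A)}\prod_{e\in A}v_e$ is the multivariate Tutte polynomial, in variables $q^{ -1}$ and $\mathbf{v}=(v_e)_{e\in E}$. For a basis $B$: an element $e\in E\setminus B$ is externally active if $e$ is dependent on the elements of $B$ following $e$ in the total order (i.e. $\rk(\{b\in B:b>e\}\cup\{e\})=\rk(\{b\in B:b>e\})$); an element $e\in B$ is internally active if there is no $f\in E$ preceding $e$ such that $(B\setminus\{e\})\cup\{f\}$ is a basis. $E(B)$ and $I(B)$ are the sets of externally and internally active elements of $B$. -}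

module Defs where

open import Level using (Level)
open import Data.Nat using (ℕ; zero; suc; _≤_; _≡ᵇ_; _<ᵇ_)
import Data.Nat as N
open import Data.Bool using (Bool; true; false; if_then_else_; _∧_; not)
open import Data.Fin using (Fin; toℕ)
open import Data.Fin.Subset using (Subset; _∪_; _∩_; _⊆_; ∣_∣; ⁅_⁆; _-_) renaming (⊥ to ∅; ⊤ to full)
open import Data.Vec using (Vec; []; _∷_; tabulate; lookup; allFin)
open import Data.List using (List; []; _∷_; _++_; map; filter)
import Data.List as L
open import Relation.Nullary.Decidable using (does)
open import Data.Bool using (_≟_)
open import Algebra.Bundles using (CommutativeRing)

allB : {A : Set} → (A → Bool) → List A → Bool
allB p []       = true
allB p (x ∷ xs) = p x ∧ allB p xs

allSubsets : (n : ℕ) → List (Subset n)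
allSubsets zero    = [] ∷ []
allSubsets (suc n) = map (true ∷_) (allSubsets n) ++ map (false ∷_) (allSubsets n)

-- A matroid on the ground set E = Fin n, totally ordered by the order of Fin n,
-- given by its rank function (standard rank axioms).
record Matroid (n : ℕ) : Set where
  field
    rk        : Subset n → ℕ
    rk-bound  : ∀ A → rk A ≤ ∣ A ∣
    rk-mono   : ∀ A B → A ⊆ B → rk A ≤ rk B
    rk-submod : ∀ A B → rk (A ∪ B) N.+ rk (A ∩ B) ≤ rk A N.+ rk B

module _ {n : ℕ} (M : Matroid n) where
  open Matroid M

  isBasis : Subset n → Bool
  isBasis B = (rk B ≡ᵇ ∣ B ∣) ∧ (rk B ≡ᵇ rk full)

  bases : List (Subset n)
  bases = filter (λ B → isBasis B ≟ true) (allSubsets n)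

  above : Subset n → Fin n → Subset n
  above B e = B ∩ tabulate (λ b → toℕ e <ᵇ toℕ b)

  extActive : Subset n → Fin n → Bool
  extActive B e = not (lookup B e) ∧ (rk (above B e ∪ ⁅ e ⁆) ≡ᵇ rk (above B e))

  intActive : Subset n → Fin n → Bool
  intActive B e = lookup B e ∧
    allB (λ f → not ((toℕ f <ᵇ toℕ e) ∧ isBasis ((B - e) ∪ ⁅ f ⁆))) (L.tabulate (λ i → i))

  E[_] : Subset n → Subset n
  E[ B ] = tabulate (extActive B)

  I[_] : Subset n → Subset n
  I[ B ] = tabulate (intActive B)

module RingOps {c ℓ : Level} (R : CommutativeRing c ℓ) where
  open CommutativeRing R

  pow : Carrier → ℕ → Carrier
  pow x zero    = 1#
  pow x (suc k) = x * pow x k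

  sumL : {A : Set} → (A → Carrier) → List A → Carrier
  sumL f []       = 0#
  sumL f (x ∷ xs) = f x + sumL f xs

  prodOver : {n : ℕ} → Subset n → (Fin n → Carrier) → Carrier
  prodOver A f = Data.Vec.foldr _ (λ {i → λ acc → (if lookup A i then f i else 1#) * acc}) 1# (allFin _)
    where open import Data.Vec using (foldr)

  -- Multivariate Tutte polynomial Z_M(q,v), with qinv playing the role of q^{-1}
  Z : {n : ℕ} → Matroid n → (qinv : Carrier) → (v : Fin n → Carrier) → Carrier
  Z {n} M qinv v = sumL (λ A → pow qinv (Matroid.rk M A) * prodOver A v) (allSubsets n)

-- Deletion–contraction on the largest element ω, with subsets of E written X ∷ʳ b
-- (b records whether ω ∈ X). For e < ω, external activity only inspects basis elements
-- after e and internal activity only exchanges with elements before e, so the activity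
-- of e in M with respect to B ∷ʳ true (resp. B ∷ʳ false) is its activity in M/ω
-- (resp. M∖ω) with respect to B. Hence the basis sum obeys the recursion of Z: a loop ω
-- is externally active in every basis (factor v_ω + 1), a coloop ω lies in every basis and
-- is internally active (factor v_ω (q/v_ω + 1)), and otherwise the bases split into bases
-- of M/ω plus ω and bases of M∖ω, with ω inactive in both. Splitting the subsets in Z the
-- same way gives Z_M = q^{-rk{ω}} v_ω Z_{M/ω} + Z_{M∖ω}, and induction on |E| finishes.
module Submission where

open import Data.Bool using (Bool; true; false; if_then_else_; _∧_; _∨_; not)
open import Data.Bool.Properties using (∧-assoc; ∧-identityʳ; ∧-zeroʳ; ∨-identityʳ; T-≡)
open import Data.Nat using (ℕ; zero; suc; _≤_; _<_; _≡ᵇ_; _<ᵇ_; _∸_; z≤n; s≤s) renaming (_+_ to _+ℕ_)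
import Data.Nat.Properties as ℕ
open import Data.Fin using (Fin; toℕ; inject₁; fromℕ) renaming (zero to fzero; suc to fsuc)
open import Data.Fin.Properties using (toℕ-inject₁; toℕ-fromℕ; toℕ<n; ≤fromℕ; ¬∀⟶∃¬)
open import Data.Fin.Subset
  using (Subset; _∪_; _∩_; _─_; _-_; _⊆_; ⁅_⁆; ∣_∣; ⋃) renaming (⊥ to ∅; ⊤ to full)
open import Data.Fin.Subset.Properties
  using (∣⊥∣≡0; ∣⁅x⁆∣≡1; p⊆p∪q; q⊆p∪q; drop-∷-⊆; ⊆⊤; ∪-identityˡ; ∪-identityʳ; ∪-zeroʳ;
         ∩-identityʳ; ∩-zeroʳ; ∪-distribˡ-∩; p─⊥≡p)
open import Data.Vec using (Vec; []; _∷_; _∷ʳ_; tabulate; lookup; replicate; zipWith; here; there)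
open import Data.Vec.Properties using (tabulate-cong)
import Data.List as List
open import Data.Product using (∃; _×_; _,_; proj₁; proj₂)
open import Data.Sum using (inj₁; inj₂)
open import Data.Empty using (⊥-elim)
open import Function using (_∘_; id)
open import Function.Bundles using (Equivalence)
open import Relation.Nullary using (¬_)
open import Relation.Binary.PropositionalEquality using (_≡_; _≢_; refl; sym; trans; cong; cong₂; subst; subst₂)
open import Level using (Level)
open import Algebra.Bundles using (CommutativeRing)
import Data.Bool as Bool
import Data.Vec as Vec
open import Defs

private
  variable
    n : ℕ

zipWith-∷ʳ : ∀ {A B C : Set} (f : A → B → C) (xs : Vec A n) (ys : Vec B n) x y →
             zipWith f (xs ∷ʳ x) (ys ∷ʳ y) ≡ zipWith f xs ys ∷ʳ f x y
zipWith-∷ʳ f []       []       x y = refl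
zipWith-∷ʳ f (a ∷ xs) (b ∷ ys) x y = cong (f a b ∷_) (zipWith-∷ʳ f xs ys x y)

replicate-∷ʳ : ∀ {A : Set} n (x : A) → replicate (suc n) x ≡ replicate n x ∷ʳ x
replicate-∷ʳ zero    x = refl
replicate-∷ʳ (suc n) x = cong (x ∷_) (replicate-∷ʳ n x)

tabulate-const : ∀ {A : Set} n (x : A) → tabulate {n = n} (λ _ → x) ≡ replicate n x
tabulate-const zero    x = refl
tabulate-const (suc n) x = cong (x ∷_) (tabulate-const n x)

tabulate-∷ʳ : ∀ {A : Set} n (f : Fin (suc n) → A) → tabulate f ≡ tabulate (f ∘ inject₁) ∷ʳ f (fromℕ n)
tabulate-∷ʳ zero    f = refl
tabulate-∷ʳ (suc n) f = cong (f fzero ∷_) (tabulate-∷ʳ n (f ∘ fsuc))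

lookup-∷ʳ-inject₁ : ∀ {A : Set} (xs : Vec A n) x i → lookup (xs ∷ʳ x) (inject₁ i) ≡ lookup xs i
lookup-∷ʳ-inject₁ (a ∷ xs) x fzero    = refl
lookup-∷ʳ-inject₁ (a ∷ xs) x (fsuc i) = lookup-∷ʳ-inject₁ xs x i

lookup-∷ʳ-fromℕ : ∀ {A : Set} (xs : Vec A n) x → lookup (xs ∷ʳ x) (fromℕ n) ≡ x
lookup-∷ʳ-fromℕ []       x = refl
lookup-∷ʳ-fromℕ (a ∷ xs) x = lookup-∷ʳ-fromℕ xs x

∪-∷ʳ : ∀ (p q : Subset n) x y → (p ∷ʳ x) ∪ (q ∷ʳ y) ≡ (p ∪ q) ∷ʳ (x ∨ y)
∪-∷ʳ = zipWith-∷ʳ _∨_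

∩-∷ʳ : ∀ (p q : Subset n) x y → (p ∷ʳ x) ∩ (q ∷ʳ y) ≡ (p ∩ q) ∷ʳ (x ∧ y)
∩-∷ʳ = zipWith-∷ʳ _∧_

─-∷ʳ-outside : ∀ (p q : Subset n) x → (p ∷ʳ x) ─ (q ∷ʳ false) ≡ (p ─ q) ∷ʳ x
─-∷ʳ-outside []      []          x = refl
─-∷ʳ-outside (a ∷ p) (true ∷ q)  x = cong (false ∷_) (─-∷ʳ-outside p q x)
─-∷ʳ-outside (a ∷ p) (false ∷ q) x = cong (a ∷_) (─-∷ʳ-outside p q x)

─-∷ʳ-inside : ∀ (p q : Subset n) x → (p ∷ʳ x) ─ (q ∷ʳ true) ≡ (p ─ q) ∷ʳ false
─-∷ʳ-inside []      []          x = refl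
─-∷ʳ-inside (a ∷ p) (true ∷ q)  x = cong (false ∷_) (─-∷ʳ-inside p q x)
─-∷ʳ-inside (a ∷ p) (false ∷ q) x = cong (a ∷_) (─-∷ʳ-inside p q x)

∅-∷ʳ : ∀ {n} → ∅ {suc n} ≡ ∅ ∷ʳ false
∅-∷ʳ {n} = replicate-∷ʳ n false

full-∷ʳ : ∀ {n} → full {suc n} ≡ full ∷ʳ true
full-∷ʳ {n} = replicate-∷ʳ n true

∣p∷ʳfalse∣ : ∀ (p : Subset n) → ∣ p ∷ʳ false ∣ ≡ ∣ p ∣
∣p∷ʳfalse∣ []          = refl
∣p∷ʳfalse∣ (true ∷ p)  = cong suc (∣p∷ʳfalse∣ p)
∣p∷ʳfalse∣ (false ∷ p) = ∣p∷ʳfalse∣ p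

∣p∷ʳtrue∣ : ∀ (p : Subset n) → ∣ p ∷ʳ true ∣ ≡ suc ∣ p ∣
∣p∷ʳtrue∣ []          = refl
∣p∷ʳtrue∣ (true ∷ p)  = cong suc (∣p∷ʳtrue∣ p)
∣p∷ʳtrue∣ (false ∷ p) = ∣p∷ʳtrue∣ p

⊆-∷ʳ : ∀ {p q : Subset n} x → p ⊆ q → (p ∷ʳ x) ⊆ (q ∷ʳ x)
⊆-∷ʳ {p = []}    {[]}    x p⊆q here       = here
⊆-∷ʳ {p = _ ∷ _} {_ ∷ _} x p⊆q here       with p⊆q here
... | here = here
⊆-∷ʳ {p = _ ∷ _} {_ ∷ _} x p⊆q (there i∈) = there (⊆-∷ʳ x (drop-∷-⊆ p⊆q) i∈)

⁅inject₁⁆ : ∀ (i : Fin n) → ⁅ inject₁ i ⁆ ≡ ⁅ i ⁆ ∷ʳ false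
⁅inject₁⁆ fzero    = cong (true ∷_) ∅-∷ʳ
⁅inject₁⁆ (fsuc i) = cong (false ∷_) (⁅inject₁⁆ i)

⁅fromℕ⁆ : ∀ n → ⁅ fromℕ n ⁆ ≡ ∅ ∷ʳ true
⁅fromℕ⁆ zero    = refl
⁅fromℕ⁆ (suc n) = cong (false ∷_) (⁅fromℕ⁆ n)

-∷ʳ-inject₁ : ∀ (p : Subset n) x i → (p ∷ʳ x) - inject₁ i ≡ (p - i) ∷ʳ x
-∷ʳ-inject₁ p x i = trans (cong ((p ∷ʳ x) ─_) (⁅inject₁⁆ i)) (─-∷ʳ-outside p ⁅ i ⁆ x)

-∷ʳ-fromℕ : ∀ (p : Subset n) x → (p ∷ʳ x) - fromℕ n ≡ p ∷ʳ false
-∷ʳ-fromℕ {n} p x =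
  trans (cong ((p ∷ʳ x) ─_) (⁅fromℕ⁆ n)) (trans (─-∷ʳ-inside p ∅ x) (cong (_∷ʳ false) (p─⊥≡p p)))

∣p∪q∣≤∣p∣+∣q∣ : ∀ (p q : Subset n) → ∣ p ∪ q ∣ ≤ ∣ p ∣ +ℕ ∣ q ∣
∣p∪q∣≤∣p∣+∣q∣ []          []          = z≤n
∣p∪q∣≤∣p∣+∣q∣ (true ∷ p)  (false ∷ q) = s≤s (∣p∪q∣≤∣p∣+∣q∣ p q)
∣p∪q∣≤∣p∣+∣q∣ (true ∷ p)  (true ∷ q)  =
  s≤s (subst (∣ p ∪ q ∣ ≤_) (sym (ℕ.+-suc _ _)) (ℕ.m≤n⇒m≤1+n (∣p∪q∣≤∣p∣+∣q∣ p q)))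
∣p∪q∣≤∣p∣+∣q∣ (false ∷ p) (true ∷ q)  =
  subst (suc ∣ p ∪ q ∣ ≤_) (sym (ℕ.+-suc _ _)) (s≤s (∣p∪q∣≤∣p∣+∣q∣ p q))
∣p∪q∣≤∣p∣+∣q∣ (false ∷ p) (false ∷ q) = ∣p∪q∣≤∣p∣+∣q∣ p q

∪-distribˡ-∪ : ∀ (p q r : Subset n) → p ∪ (q ∪ r) ≡ (p ∪ q) ∪ (p ∪ r)
∪-distribˡ-∪ []          []      []      = refl
∪-distribˡ-∪ (true ∷ p)  (_ ∷ q) (_ ∷ r) = cong (true ∷_) (∪-distribˡ-∪ p q r)
∪-distribˡ-∪ (false ∷ p) (_ ∷ q) (_ ∷ r) = cong (_ ∷_) (∪-distribˡ-∪ p q r)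

⋃-⁅tabulate-fsuc⁆ : ∀ {m k} (f : Fin k → Fin m) →
                    ⋃ (List.map ⁅_⁆ (List.tabulate (fsuc ∘ f))) ≡ false ∷ ⋃ (List.map ⁅_⁆ (List.tabulate f))
⋃-⁅tabulate-fsuc⁆ {k = zero}  f = refl
⋃-⁅tabulate-fsuc⁆ {k = suc k} f = cong (⁅ fsuc (f fzero) ⁆ ∪_) (⋃-⁅tabulate-fsuc⁆ (f ∘ fsuc))

⋃-⁅allFin⁆ : ∀ m → ⋃ (List.map ⁅_⁆ (List.allFin m)) ≡ full
⋃-⁅allFin⁆ zero    = refl
⋃-⁅allFin⁆ (suc m) = trans (cong (⁅ fzero ⁆ ∪_) (⋃-⁅tabulate-fsuc⁆ id))
                           (cong (true ∷_) (trans (∪-identityˡ _) (⋃-⁅allFin⁆ m)))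

≡⇒≡ᵇ-true : ∀ {m n} → m ≡ n → (m ≡ᵇ n) ≡ true
≡⇒≡ᵇ-true {m} {n} m≡n = Equivalence.to T-≡ (ℕ.≡⇒≡ᵇ m n m≡n)

≡ᵇ-true⇒≡ : ∀ {m n} → (m ≡ᵇ n) ≡ true → m ≡ n
≡ᵇ-true⇒≡ {m} {n} eq = ℕ.≡ᵇ⇒≡ m n (Equivalence.from T-≡ eq)

≢⇒≡ᵇ-false : ∀ {m n} → m ≢ n → (m ≡ᵇ n) ≡ false
≢⇒≡ᵇ-false {m} {n} m≢n with m ≡ᵇ n in eq
... | true  = ⊥-elim (m≢n (≡ᵇ-true⇒≡ eq))
... | false = refl

≡ᵇ-∸ : ∀ k m n → k ≤ m → k ≤ n → ((m ∸ k) ≡ᵇ (n ∸ k)) ≡ (m ≡ᵇ n)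
≡ᵇ-∸ zero    m       n       _       _       = refl
≡ᵇ-∸ (suc k) (suc m) (suc n) (s≤s p) (s≤s q) = ≡ᵇ-∸ k m n p q

<⇒<ᵇ-true : ∀ {m n} → m < n → (m <ᵇ n) ≡ true
<⇒<ᵇ-true m<n = Equivalence.to T-≡ (ℕ.<⇒<ᵇ m<n)

≤⇒<ᵇ-false : ∀ {m n} → n ≤ m → (m <ᵇ n) ≡ false
≤⇒<ᵇ-false z≤n     = refl
≤⇒<ᵇ-false (s≤s p) = ≤⇒<ᵇ-false p

∧-true⁻¹ : ∀ {x y} → (x ∧ y) ≡ true → x ≡ true × y ≡ true
∧-true⁻¹ {true} {true} _ = refl , refl

∸-+-mono-≤ : ∀ k {a b c d} → k ≤ a → k ≤ b → k ≤ c → k ≤ d →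
             a +ℕ b ≤ c +ℕ d → (a ∸ k) +ℕ (b ∸ k) ≤ (c ∸ k) +ℕ (d ∸ k)
∸-+-mono-≤ zero    _       _       _       _       ab≤cd = ab≤cd
∸-+-mono-≤ (suc k) {suc a} {suc b} {suc c} {suc d} (s≤s k≤a) (s≤s k≤b) (s≤s k≤c) (s≤s k≤d) ab≤cd =
  ∸-+-mono-≤ k k≤a k≤b k≤c k≤d (ℕ.≤-pred (subst₂ _≤_ (ℕ.+-suc a b) (ℕ.+-suc c d) (ℕ.≤-pred ab≤cd)))

allB-tabulate-∷ʳ : ∀ {A : Set} n (p : A → Bool) (f : Fin (suc n) → A) →
                   allB p (List.tabulate f) ≡ allB p (List.tabulate (f ∘ inject₁)) ∧ p (f (fromℕ n))
allB-tabulate-∷ʳ zero    p f = ∧-identityʳ (p (f fzero))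
allB-tabulate-∷ʳ (suc n) p f =
  trans (cong (p (f fzero) ∧_) (allB-tabulate-∷ʳ n p (f ∘ fsuc))) (sym (∧-assoc (p (f fzero)) _ _))

allB-tabulate-cong : ∀ {A B : Set} n {p : A → Bool} {q : B → Bool} {f : Fin n → A} {g : Fin n → B} →
                     (∀ i → p (f i) ≡ q (g i)) → allB p (List.tabulate f) ≡ allB q (List.tabulate g)
allB-tabulate-cong zero    eq = refl
allB-tabulate-cong (suc n) eq = cong₂ _∧_ (eq fzero) (allB-tabulate-cong n (eq ∘ fsuc))

allB-tabulate-false : ∀ {A : Set} n (p : A → Bool) (f : Fin n → A) i → p (f i) ≡ false →
                      allB p (List.tabulate f) ≡ false
allB-tabulate-false (suc n) p f fzero    eq rewrite eq = refl
allB-tabulate-false (suc n) p f (fsuc i) eq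
  rewrite allB-tabulate-false n p (f ∘ fsuc) i eq = ∧-zeroʳ (p (f fzero))

allB-tabulate-true : ∀ {A : Set} n (p : A → Bool) (f : Fin n → A) → (∀ i → p (f i) ≡ true) →
                     allB p (List.tabulate f) ≡ true
allB-tabulate-true zero    p f eq = refl
allB-tabulate-true (suc n) p f eq rewrite eq fzero = allB-tabulate-true n p (f ∘ fsuc) (eq ∘ fsuc)

module MatroidProperties {m} (M : Matroid m) where
  open Matroid M

  rk-∅ : rk ∅ ≡ 0
  rk-∅ = ℕ.n≤0⇒n≡0 (subst (rk ∅ ≤_) (∣⊥∣≡0 m) (rk-bound ∅))

  rk-∪-≤ : ∀ A B → rk (A ∪ B) ≤ rk A +ℕ rk B
  rk-∪-≤ A B = ℕ.≤-trans (ℕ.m≤m+n _ _) (rk-submod A B)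

  rk-∪ˡ : ∀ A B → rk A ≤ rk (A ∪ B)
  rk-∪ˡ A B = rk-mono A (A ∪ B) (p⊆p∪q B)

  rk-∪ʳ : ∀ A B → rk B ≤ rk (A ∪ B)
  rk-∪ʳ A B = rk-mono B (A ∪ B) (q⊆p∪q A B)

  isBasis⁻ : ∀ {X} → isBasis M X ≡ true → rk X ≡ ∣ X ∣ × rk X ≡ rk full
  isBasis⁻ X-basis with ∧-true⁻¹ X-basis
  ... | independent , spanning = ≡ᵇ-true⇒≡ independent , ≡ᵇ-true⇒≡ spanning

  isBasis⁺ : ∀ {X} → rk X ≡ ∣ X ∣ → rk X ≡ rk full → isBasis M X ≡ true
  isBasis⁺ independent spanning = cong₂ _∧_ (≡⇒≡ᵇ-true independent) (≡⇒≡ᵇ-true spanning)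

  rk-∪-⋃-closed : ∀ X → (∀ g → rk (X ∪ ⁅ g ⁆) ≡ rk X) →
                  ∀ gs → rk (X ∪ ⋃ (List.map ⁅_⁆ gs)) ≡ rk X
  rk-∪-⋃-closed X closed List.[]         = cong rk (∪-identityʳ X)
  rk-∪-⋃-closed X closed (g List.∷ gs) = ℕ.≤-antisym upper (rk-∪ˡ X (⁅ g ⁆ ∪ G))
    where
    G = ⋃ (List.map ⁅_⁆ gs)
    submod : rk (X ∪ (⁅ g ⁆ ∪ G)) +ℕ rk (X ∪ (⁅ g ⁆ ∩ G)) ≤ rk X +ℕ rk X
    submod = subst₂ (λ U V → rk U +ℕ rk V ≤ rk X +ℕ rk X)
               (sym (∪-distribˡ-∪ X ⁅ g ⁆ G)) (sym (∪-distribˡ-∩ X ⁅ g ⁆ G))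
               (subst₂ (λ a b → rk ((X ∪ ⁅ g ⁆) ∪ (X ∪ G)) +ℕ rk ((X ∪ ⁅ g ⁆) ∩ (X ∪ G)) ≤ a +ℕ b)
                 (closed g) (rk-∪-⋃-closed X closed gs) (rk-submod (X ∪ ⁅ g ⁆) (X ∪ G)))
    upper : rk (X ∪ (⁅ g ⁆ ∪ G)) ≤ rk X
    upper = ℕ.+-cancelʳ-≤ (rk X) _ _ (ℕ.≤-trans (ℕ.+-monoʳ-≤ _ (rk-∪ˡ X (⁅ g ⁆ ∩ G))) submod)

  -- A set closed under all single-element extensions already has full rank.
  rank-raising-element : ∀ X → rk X < rk full → ∃ λ g → rk (X ∪ ⁅ g ⁆) ≢ rk X
  rank-raising-element X X<full = ¬∀⟶∃¬ m _ (λ g → rk (X ∪ ⁅ g ⁆) ℕ.≟ rk X) closed⇒full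
    where
    closed⇒full : ¬ (∀ g → rk (X ∪ ⁅ g ⁆) ≡ rk X)
    closed⇒full closed = ℕ.<-irrefl rkX≡rkfull X<full
      where
      rkX≡rkfull : rk X ≡ rk full
      rkX≡rkfull = trans (sym (rk-∪-⋃-closed X closed (List.allFin m)))
                         (cong rk (trans (cong (X ∪_) (⋃-⁅allFin⁆ m)) (∪-zeroʳ X)))

module LastElement {n : ℕ} (M : Matroid (suc n)) where
  open Matroid M
  open MatroidProperties M

  ω : Fin (suc n)
  ω = fromℕ n

  rk-ω : ℕ
  rk-ω = rk (∅ ∷ʳ true)

  rk₀ rk₁ : Subset n → ℕ
  rk₀ X = rk (X ∷ʳ false)
  rk₁ X = rk (X ∷ʳ true)

  private
    ∷ʳtrue≡∷ʳfalse∪ω : ∀ (X : Subset n) → X ∷ʳ true ≡ (X ∷ʳ false) ∪ (∅ ∷ʳ true)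
    ∷ʳtrue≡∷ʳfalse∪ω X = sym (trans (∪-∷ʳ X ∅ false true) (cong (_∷ʳ true) (∪-identityʳ X)))

  rk₁≤rk₀+rk-ω : ∀ (X : Subset n) → rk₁ X ≤ rk₀ X +ℕ rk-ω
  rk₁≤rk₀+rk-ω X = subst (λ Y → rk Y ≤ rk₀ X +ℕ rk-ω) (sym (∷ʳtrue≡∷ʳfalse∪ω X)) (rk-∪-≤ _ _)

  rk₀≤rk₁ : ∀ (X : Subset n) → rk₀ X ≤ rk₁ X
  rk₀≤rk₁ X = subst (λ Y → rk₀ X ≤ rk Y) (sym (∷ʳtrue≡∷ʳfalse∪ω X)) (rk-∪ˡ _ _)

  rk-ω≤rk₁ : ∀ (X : Subset n) → rk-ω ≤ rk₁ X
  rk-ω≤rk₁ X = subst (λ Y → rk-ω ≤ rk Y) (sym (∷ʳtrue≡∷ʳfalse∪ω X)) (rk-∪ʳ _ _)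

  rk-ω≤1 : rk-ω ≤ 1
  rk-ω≤1 = subst (rk-ω ≤_) (trans (∣p∷ʳtrue∣ (∅ {n})) (cong suc (∣⊥∣≡0 n))) (rk-bound (∅ ∷ʳ true))

  rk₀≤∣∣ : ∀ (X : Subset n) → rk₀ X ≤ ∣ X ∣
  rk₀≤∣∣ X = subst (rk₀ X ≤_) (∣p∷ʳfalse∣ X) (rk-bound (X ∷ʳ false))

  rk₀≤rk₀-full : ∀ (X : Subset n) → rk₀ X ≤ rk₀ full
  rk₀≤rk₀-full X = rk-mono _ _ (⊆-∷ʳ false ⊆⊤)

  rk-full : rk full ≡ rk₁ full
  rk-full = cong rk full-∷ʳ

  deletion : Matroid n
  deletion = record
    { rk        = rk₀
    ; rk-bound  = rk₀≤∣∣
    ; rk-mono   = λ A B A⊆B → rk-mono _ _ (⊆-∷ʳ false A⊆B)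
    ; rk-submod = λ A B → subst₂ (λ U V → rk U +ℕ rk V ≤ rk₀ A +ℕ rk₀ B)
        (∪-∷ʳ A B false false) (∩-∷ʳ A B false false) (rk-submod (A ∷ʳ false) (B ∷ʳ false))
    }

  -- The subtraction never truncates, since rk-ω ≤ rk₁ X.
  contraction : Matroid n
  contraction = record
    { rk        = λ X → rk₁ X ∸ rk-ω
    ; rk-bound  = λ X → ℕ.m≤n+o⇒m∸n≤o (rk₁ X) rk-ω
        (ℕ.≤-trans (rk₁≤rk₀+rk-ω X)
          (subst (_≤ rk-ω +ℕ ∣ X ∣) (ℕ.+-comm rk-ω (rk₀ X)) (ℕ.+-monoʳ-≤ rk-ω (rk₀≤∣∣ X))))
    ; rk-mono   = λ A B A⊆B → ℕ.∸-monoˡ-≤ rk-ω (rk-mono _ _ (⊆-∷ʳ true A⊆B))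
    ; rk-submod = λ A B → ∸-+-mono-≤ rk-ω (rk-ω≤rk₁ (A ∪ B)) (rk-ω≤rk₁ (A ∩ B)) (rk-ω≤rk₁ A) (rk-ω≤rk₁ B)
        (subst₂ (λ U V → rk U +ℕ rk V ≤ rk₁ A +ℕ rk₁ B)
          (∪-∷ʳ A B true true) (∩-∷ʳ A B true true) (rk-submod (A ∷ʳ true) (B ∷ʳ true)))
    }

  -- ω is a coloop iff deleting it lowers the rank; regular means neither loop nor coloop.
  data Kind : Set where
    loop    : rk-ω ≡ 0 → Kind
    coloop  : rk₀ full < rk₁ full → Kind
    regular : rk-ω ≡ 1 → rk₀ full ≡ rk₁ full → Kind

  kind : Kind
  kind with ℕ.m≤n⇒m<n∨m≡n rk-ω≤1
  ... | inj₁ rk-ω<1 = loop (ℕ.n<1⇒n≡0 rk-ω<1)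
  ... | inj₂ rk-ω≡1 with ℕ.m≤n⇒m<n∨m≡n (rk₀≤rk₁ full)
  ...   | inj₁ coloop-ω = coloop coloop-ω
  ...   | inj₂ rk₀≡rk₁ = regular rk-ω≡1 rk₀≡rk₁

  loop⇒rk₁≡rk₀ : rk-ω ≡ 0 → ∀ (X : Subset n) → rk₁ X ≡ rk₀ X
  loop⇒rk₁≡rk₀ rk-ω≡0 X = ℕ.≤-antisym
    (subst (rk₁ X ≤_) (trans (cong (rk₀ X +ℕ_) rk-ω≡0) (ℕ.+-identityʳ _)) (rk₁≤rk₀+rk-ω X))
    (rk₀≤rk₁ X)

  coloop⇒rk-ω≡1 : rk₀ full < rk₁ full → rk-ω ≡ 1
  coloop⇒rk-ω≡1 coloop-ω = ℕ.≤-antisym rk-ω≤1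
    (ℕ.+-cancelˡ-≤ (rk₀ full) 1 rk-ω
      (subst (_≤ rk₀ full +ℕ rk-ω) (ℕ.+-comm 1 (rk₀ full)) (ℕ.≤-trans coloop-ω (rk₁≤rk₀+rk-ω full))))

  -- Submodularity applied to X ∷ʳ true and full ∷ʳ false.
  coloop⇒rk₁≡1+rk₀ : rk₀ full < rk₁ full → ∀ (X : Subset n) → rk₁ X ≡ suc (rk₀ X)
  coloop⇒rk₁≡1+rk₀ coloop-ω X = ℕ.≤-antisym upper lower
    where
    upper : rk₁ X ≤ suc (rk₀ X)
    upper = subst (rk₁ X ≤_) (trans (cong (rk₀ X +ℕ_) (coloop⇒rk-ω≡1 coloop-ω)) (ℕ.+-comm (rk₀ X) 1))
                  (rk₁≤rk₀+rk-ω X)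
    union : (X ∷ʳ true) ∪ (full ∷ʳ false) ≡ full
    union = trans (∪-∷ʳ X full true false) (trans (cong (_∷ʳ true) (∪-zeroʳ X)) (sym full-∷ʳ))
    inter : (X ∷ʳ true) ∩ (full ∷ʳ false) ≡ X ∷ʳ false
    inter = trans (∩-∷ʳ X full true false) (cong (_∷ʳ false) (∩-identityʳ X))
    submod : rk₁ full +ℕ rk₀ X ≤ rk₁ X +ℕ rk₀ full
    submod = subst₂ (λ a b → a +ℕ b ≤ rk₁ X +ℕ rk₀ full) (trans (cong rk union) rk-full) (cong rk inter)
                    (rk-submod (X ∷ʳ true) (full ∷ʳ false))
    lower : suc (rk₀ X) ≤ rk₁ X
    lower = ℕ.+-cancelʳ-≤ (rk₀ full) _ _
      (subst (_≤ rk₁ X +ℕ rk₀ full) (cong suc (ℕ.+-comm (rk₀ full) (rk₀ X)))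
        (ℕ.≤-trans (ℕ.+-monoˡ-≤ (rk₀ X) coloop-ω) submod))

  loop⇒contraction≗deletion : rk-ω ≡ 0 → ∀ X → Matroid.rk contraction X ≡ Matroid.rk deletion X
  loop⇒contraction≗deletion rk-ω≡0 X = trans (cong (rk₁ X ∸_) rk-ω≡0) (loop⇒rk₁≡rk₀ rk-ω≡0 X)

  coloop⇒contraction≗deletion : rk₀ full < rk₁ full → ∀ X → Matroid.rk contraction X ≡ Matroid.rk deletion X
  coloop⇒contraction≗deletion coloop-ω X =
    trans (cong (rk₁ X ∸_) (coloop⇒rk-ω≡1 coloop-ω)) (cong (_∸ 1) (coloop⇒rk₁≡1+rk₀ coloop-ω X))

  inject₁<ω : ∀ (i : Fin n) → toℕ (inject₁ i) < toℕ ω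
  inject₁<ω i = subst₂ _<_ (sym (toℕ-inject₁ i)) (sym (toℕ-fromℕ n)) (toℕ<n i)

  above-∷ʳ-inject₁ : ∀ (B : Subset n) b i → above M (B ∷ʳ b) (inject₁ i) ≡ above deletion B i ∷ʳ b
  above-∷ʳ-inject₁ B b i =
    trans (cong ((B ∷ʳ b) ∩_) later) (trans (∩-∷ʳ B _ b true) (cong (_ ∷ʳ_) (∧-identityʳ b)))
    where
    later : tabulate (λ c → toℕ (inject₁ i) <ᵇ toℕ c) ≡ tabulate (λ c → toℕ i <ᵇ toℕ c) ∷ʳ true
    later = trans (tabulate-∷ʳ n (λ c → toℕ (inject₁ i) <ᵇ toℕ c))
      (cong₂ _∷ʳ_ (tabulate-cong (λ c → cong₂ _<ᵇ_ (toℕ-inject₁ i) (toℕ-inject₁ c)))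
                  (<⇒<ᵇ-true (inject₁<ω i)))

  above-ω : ∀ B → above M B ω ≡ ∅
  above-ω B = trans (cong (B ∩_) nothing-after-ω) (∩-zeroʳ B)
    where
    nothing-after-ω : tabulate (λ c → toℕ ω <ᵇ toℕ c) ≡ ∅
    nothing-after-ω = trans (tabulate-cong (λ c → ≤⇒<ᵇ-false (≤fromℕ c))) (tabulate-const _ false)

  extActive-∷ʳfalse-inject₁ : ∀ (B : Subset n) i → extActive M (B ∷ʳ false) (inject₁ i) ≡ extActive deletion B i
  extActive-∷ʳfalse-inject₁ B i
    rewrite lookup-∷ʳ-inject₁ B false i | above-∷ʳ-inject₁ B false i | ⁅inject₁⁆ i
          | ∪-∷ʳ (above deletion B i) ⁅ i ⁆ false false = refl

  extActive-∷ʳtrue-inject₁ : ∀ (B : Subset n) i → extActive M (B ∷ʳ true) (inject₁ i) ≡ extActive contraction B i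
  extActive-∷ʳtrue-inject₁ B i
    rewrite lookup-∷ʳ-inject₁ B true i | above-∷ʳ-inject₁ B true i | ⁅inject₁⁆ i
          | ∪-∷ʳ (above deletion B i) ⁅ i ⁆ true false =
      cong (not (lookup B i) ∧_) (sym (≡ᵇ-∸ rk-ω _ _ (rk-ω≤rk₁ _) (rk-ω≤rk₁ _)))

  extActive-ω : ∀ (B : Subset n) b → extActive M (B ∷ʳ b) ω ≡ not b ∧ (rk-ω ≡ᵇ 0)
  extActive-ω B b
    rewrite lookup-∷ʳ-fromℕ B b | above-ω (B ∷ʳ b) | ∪-identityˡ ⁅ ω ⁆ | ⁅fromℕ⁆ n | rk-∅ = refl

  intActive-∷ʳ-inject₁ : ∀ (N : Matroid n) b → (∀ X → isBasis M (X ∷ʳ b) ≡ isBasis N X) →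
                         ∀ (B : Subset n) i → intActive M (B ∷ʳ b) (inject₁ i) ≡ intActive N B i
  intActive-∷ʳ-inject₁ N b bases-agree B i = cong₂ _∧_ (lookup-∷ʳ-inject₁ B b i)
    (trans (allB-tabulate-∷ʳ n no-earlier-exchange id)
      (trans (cong₂ _∧_ (allB-tabulate-cong n below-ω) ω-not-earlier) (∧-identityʳ _)))
    where
    no-earlier-exchange : Fin (suc n) → Bool
    no-earlier-exchange f = not ((toℕ f <ᵇ toℕ (inject₁ i)) ∧ isBasis M (((B ∷ʳ b) - inject₁ i) ∪ ⁅ f ⁆))
    below-ω : ∀ g → no-earlier-exchange (inject₁ g) ≡ not ((toℕ g <ᵇ toℕ i) ∧ isBasis N ((B - i) ∪ ⁅ g ⁆))
    below-ω g rewrite toℕ-inject₁ g | toℕ-inject₁ i | -∷ʳ-inject₁ B b i | ⁅inject₁⁆ g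
                    | ∪-∷ʳ (B - i) ⁅ g ⁆ b false | ∨-identityʳ b | bases-agree ((B - i) ∪ ⁅ g ⁆) = refl
    ω-not-earlier : no-earlier-exchange ω ≡ true
    ω-not-earlier rewrite ≤⇒<ᵇ-false (ℕ.<⇒≤ (inject₁<ω i)) = refl

  intActive-ω : ∀ (B : Subset n) b →
                intActive M (B ∷ʳ b) ω ≡ b ∧ allB (λ g → not (isBasis M ((B ∪ ⁅ g ⁆) ∷ʳ false))) (List.allFin n)
  intActive-ω B b = cong₂ _∧_ (lookup-∷ʳ-fromℕ B b)
    (trans (allB-tabulate-∷ʳ n no-earlier-exchange id)
      (trans (cong₂ _∧_ (allB-tabulate-cong n below-ω) ω-not-earlier) (∧-identityʳ _)))
    where
    no-earlier-exchange : Fin (suc n) → Bool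
    no-earlier-exchange f = not ((toℕ f <ᵇ toℕ ω) ∧ isBasis M (((B ∷ʳ b) - ω) ∪ ⁅ f ⁆))
    below-ω : ∀ g → no-earlier-exchange (inject₁ g) ≡ not (isBasis M ((B ∪ ⁅ g ⁆) ∷ʳ false))
    below-ω g
      rewrite <⇒<ᵇ-true (inject₁<ω g) | -∷ʳ-fromℕ B b | ⁅inject₁⁆ g | ∪-∷ʳ B ⁅ g ⁆ false false = refl
    ω-not-earlier : no-earlier-exchange ω ≡ true
    ω-not-earlier rewrite ≤⇒<ᵇ-false (ℕ.≤-refl {toℕ ω}) = refl

  isBasis-∷ʳfalse : rk₀ full ≡ rk₁ full → ∀ (X : Subset n) → isBasis M (X ∷ʳ false) ≡ isBasis deletion X
  isBasis-∷ʳfalse rk₀≡rk₁ X rewrite ∣p∷ʳfalse∣ X | rk-full | rk₀≡rk₁ = refl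

  coloop⇒¬isBasis-∷ʳfalse : rk₀ full < rk₁ full → ∀ (X : Subset n) → isBasis M (X ∷ʳ false) ≡ false
  coloop⇒¬isBasis-∷ʳfalse coloop-ω X =
    trans (cong (λ k → (rk₀ X ≡ᵇ ∣ X ∷ʳ false ∣) ∧ (rk₀ X ≡ᵇ k)) rk-full)
          (trans (cong ((rk₀ X ≡ᵇ ∣ X ∷ʳ false ∣) ∧_) (≢⇒≡ᵇ-false not-spanning)) (∧-zeroʳ _))
    where
    not-spanning : rk₀ X ≢ rk₁ full
    not-spanning eq = ℕ.<-irrefl eq (ℕ.≤-<-trans (rk₀≤rk₀-full X) coloop-ω)

  isBasis-∷ʳtrue : rk-ω ≡ 1 → ∀ (X : Subset n) → isBasis M (X ∷ʳ true) ≡ isBasis contraction X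
  isBasis-∷ʳtrue rk-ω≡1 X rewrite ∣p∷ʳtrue∣ X | rk-full = sym (cong₂ _∧_ independent spanning)
    where
    independent : ((rk₁ X ∸ rk-ω) ≡ᵇ ∣ X ∣) ≡ (rk₁ X ≡ᵇ suc ∣ X ∣)
    independent = trans (cong (λ k → (rk₁ X ∸ k) ≡ᵇ ∣ X ∣) rk-ω≡1)
      (≡ᵇ-∸ 1 (rk₁ X) (suc ∣ X ∣) (subst (_≤ rk₁ X) rk-ω≡1 (rk-ω≤rk₁ X)) (s≤s z≤n))
    spanning : ((rk₁ X ∸ rk-ω) ≡ᵇ (rk₁ full ∸ rk-ω)) ≡ (rk₁ X ≡ᵇ rk₁ full)
    spanning = ≡ᵇ-∸ rk-ω (rk₁ X) (rk₁ full) (rk-ω≤rk₁ X) (rk-ω≤rk₁ full)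

  loop⇒¬isBasis-∷ʳtrue : rk-ω ≡ 0 → ∀ (X : Subset n) → isBasis M (X ∷ʳ true) ≡ false
  loop⇒¬isBasis-∷ʳtrue rk-ω≡0 X = cong (_∧ (rk₁ X ≡ᵇ rk full)) (≢⇒≡ᵇ-false dependent)
    where
    dependent : rk₁ X ≢ ∣ X ∷ʳ true ∣
    dependent eq = ℕ.<-irrefl refl
      (subst (_≤ ∣ X ∣) (trans (sym (loop⇒rk₁≡rk₀ rk-ω≡0 X)) (trans eq (∣p∷ʳtrue∣ X))) (rk₀≤∣∣ X))

  -- In M∖ω the independent set B has rank rk M − 1 < rk (M∖ω), so some g raises its
  -- rank, and B ∪ {g} is a basis of M avoiding ω.
  regular⇒basis-exchange : rk-ω ≡ 1 → rk₀ full ≡ rk₁ full → ∀ B → isBasis contraction B ≡ true →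
                           ∃ λ g → isBasis M ((B ∪ ⁅ g ⁆) ∷ʳ false) ≡ true
  regular⇒basis-exchange rk-ω≡1 rk₀≡rk₁ B B-basis =
    g , isBasis⁺ (trans rk₀B∪g (sym size)) (trans rk₀B∪g rk₁full⁻¹)
    where
    open MatroidProperties deletion using ()
      renaming (rank-raising-element to rk₀-raising-element; rk-∪ˡ to rk₀-∪ˡ)
    B∷ʳtrue-basis = isBasis⁻ (trans (isBasis-∷ʳtrue rk-ω≡1 B) B-basis)
    rk₁B : rk₁ B ≡ suc ∣ B ∣
    rk₁B = trans (proj₁ B∷ʳtrue-basis) (∣p∷ʳtrue∣ B)
    rk₁full⁻¹ : suc ∣ B ∣ ≡ rk full
    rk₁full⁻¹ = trans (sym rk₁B) (proj₂ B∷ʳtrue-basis)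
    rk₀B : rk₀ B ≡ ∣ B ∣
    rk₀B = ℕ.≤-antisym (rk₀≤∣∣ B) (ℕ.+-cancelʳ-≤ 1 ∣ B ∣ (rk₀ B)
      (subst₂ _≤_ (trans rk₁B (ℕ.+-comm 1 ∣ B ∣)) (cong (rk₀ B +ℕ_) rk-ω≡1) (rk₁≤rk₀+rk-ω B)))
    raising = rk₀-raising-element B
      (subst₂ _<_ (sym rk₀B) (trans rk₁full⁻¹ (trans rk-full (sym rk₀≡rk₁))) ℕ.≤-refl)
    g = proj₁ raising
    ∣B∪g∣≤1+∣B∣ : ∣ B ∪ ⁅ g ⁆ ∣ ≤ suc ∣ B ∣
    ∣B∪g∣≤1+∣B∣ = subst (∣ B ∪ ⁅ g ⁆ ∣ ≤_) (trans (cong (∣ B ∣ +ℕ_) (∣⁅x⁆∣≡1 g)) (ℕ.+-comm ∣ B ∣ 1))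
                        (∣p∪q∣≤∣p∣+∣q∣ B ⁅ g ⁆)
    rk₀B∪g : rk₀ (B ∪ ⁅ g ⁆) ≡ suc ∣ B ∣
    rk₀B∪g = ℕ.≤-antisym (ℕ.≤-trans (rk₀≤∣∣ (B ∪ ⁅ g ⁆)) ∣B∪g∣≤1+∣B∣)
      (subst (_< rk₀ (B ∪ ⁅ g ⁆)) rk₀B (ℕ.≤∧≢⇒< (rk₀-∪ˡ B ⁅ g ⁆) (λ eq → proj₂ raising (sym eq))))
    size : ∣ (B ∪ ⁅ g ⁆) ∷ʳ false ∣ ≡ suc ∣ B ∣
    size = trans (∣p∷ʳfalse∣ (B ∪ ⁅ g ⁆))
      (ℕ.≤-antisym ∣B∪g∣≤1+∣B∣ (subst (_≤ ∣ B ∪ ⁅ g ⁆ ∣) rk₀B∪g (rk₀≤∣∣ (B ∪ ⁅ g ⁆))))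

  regular⇒¬intActive-ω : rk-ω ≡ 1 → rk₀ full ≡ rk₁ full → ∀ B → isBasis contraction B ≡ true →
                         intActive M (B ∷ʳ true) ω ≡ false
  regular⇒¬intActive-ω rk-ω≡1 rk₀≡rk₁ B B-basis with regular⇒basis-exchange rk-ω≡1 rk₀≡rk₁ B B-basis
  ... | g , exchanged = trans (intActive-ω B true) (allB-tabulate-false n _ id g (cong not exchanged))

  coloop⇒intActive-ω : rk₀ full < rk₁ full → ∀ (B : Subset n) → intActive M (B ∷ʳ true) ω ≡ true
  coloop⇒intActive-ω coloop-ω B = trans (intActive-ω B true)
    (allB-tabulate-true n _ id (λ g → cong not (coloop⇒¬isBasis-∷ʳfalse coloop-ω (B ∪ ⁅ g ⁆))))

  rk-full≡1+rk-contraction : rk-ω ≡ 1 → rk full ≡ suc (Matroid.rk contraction full)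
  rk-full≡1+rk-contraction rk-ω≡1 = trans rk-full (sym (trans (cong (λ k → suc (rk₁ full ∸ k)) rk-ω≡1)
    (ℕ.m+[n∸m]≡n (subst (_≤ rk₁ full) rk-ω≡1 (rk-ω≤rk₁ full)))))

module RingSums {c ℓ : Level} (R : CommutativeRing c ℓ) where
  open CommutativeRing R renaming (refl to ≈-refl; sym to ≈-sym; trans to ≈-trans)
  open RingOps R
  open import Algebra.Solver.Ring.NaturalCoefficients.Default commutativeSemiring
  open import Relation.Binary.Reasoning.Setoid setoid

  factorIf : Bool → Carrier → Carrier
  factorIf b x = if b then x else 1#

  ∏ : ∀ n → (Fin n → Carrier) → Carrier
  ∏ zero    w = 1#
  ∏ (suc n) w = w fzero * ∏ n (w ∘ fsuc)

  ∏-cong : ∀ n {w u : Fin n → Carrier} → (∀ i → w i ≈ u i) → ∏ n w ≈ ∏ n u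
  ∏-cong zero    w≈u = ≈-refl
  ∏-cong (suc n) w≈u = *-cong (w≈u fzero) (∏-cong n (w≈u ∘ fsuc))

  ∏-∷ʳ : ∀ n (w : Fin (suc n) → Carrier) → ∏ (suc n) w ≈ ∏ n (w ∘ inject₁) * w (fromℕ n)
  ∏-∷ʳ zero    w = *-comm _ _
  ∏-∷ʳ (suc n) w = ≈-trans (*-cong ≈-refl (∏-∷ʳ n (w ∘ fsuc))) (≈-sym (*-assoc _ _ _))

  -- prodOver A f is a fold over allFin n = tabulate id.
  prodOver-tabulate : ∀ {k} m (A : Subset k) (f : Fin k → Carrier) (g : Fin m → Fin k) →
    Vec.foldr (λ _ → Carrier) (λ i acc → (if lookup A i then f i else 1#) * acc) 1# (tabulate g)
      ≡ ∏ m (λ i → factorIf (lookup A (g i)) (f (g i)))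
  prodOver-tabulate zero    A f g = refl
  prodOver-tabulate (suc m) A f g =
    cong (factorIf (lookup A (g fzero)) (f (g fzero)) *_) (prodOver-tabulate m A f (g ∘ fsuc))

  prodOver≡∏ : ∀ {n} (A : Subset n) f → prodOver A f ≡ ∏ n (λ i → factorIf (lookup A i) (f i))
  prodOver≡∏ {n} A f = prodOver-tabulate n A f id

  prodOver-∷ʳ : ∀ {n} (A : Subset n) b f →
                prodOver (A ∷ʳ b) f ≈ prodOver A (f ∘ inject₁) * factorIf b (f (fromℕ n))
  prodOver-∷ʳ {n} A b f = begin
    prodOver (A ∷ʳ b) f ≡⟨ prodOver≡∏ (A ∷ʳ b) f ⟩
    ∏ (suc n) (λ i → factorIf (lookup (A ∷ʳ b) i) (f i))
      ≈⟨ ∏-∷ʳ n (λ i → factorIf (lookup (A ∷ʳ b) i) (f i)) ⟩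
    ∏ n (λ i → factorIf (lookup (A ∷ʳ b) (inject₁ i)) (f (inject₁ i)))
      * factorIf (lookup (A ∷ʳ b) (fromℕ n)) (f (fromℕ n))
      ≈⟨ *-cong (∏-cong n (λ i → reflexive (cong (λ x → factorIf x (f (inject₁ i))) (lookup-∷ʳ-inject₁ A b i))))
                (reflexive (cong (λ x → factorIf x (f (fromℕ n))) (lookup-∷ʳ-fromℕ A b))) ⟩
    ∏ n (λ i → factorIf (lookup A i) (f (inject₁ i))) * factorIf b (f (fromℕ n))
      ≡⟨ cong (_* factorIf b (f (fromℕ n))) (sym (prodOver≡∏ A (f ∘ inject₁))) ⟩
    prodOver A (f ∘ inject₁) * factorIf b (f (fromℕ n)) ∎

  sumL-++ : ∀ {A : Set} (f : A → Carrier) xs ys → sumL f (xs List.++ ys) ≈ sumL f xs + sumL f ys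
  sumL-++ f List.[]         ys = ≈-sym (+-identityˡ _)
  sumL-++ f (x List.∷ xs) ys = ≈-trans (+-cong ≈-refl (sumL-++ f xs ys)) (≈-sym (+-assoc _ _ _))

  sumL-map : ∀ {A B : Set} (f : B → Carrier) (g : A → B) xs → sumL f (List.map g xs) ≡ sumL (f ∘ g) xs
  sumL-map f g List.[]         = refl
  sumL-map f g (x List.∷ xs) = cong (f (g x) +_) (sumL-map f g xs)

  sumL-cong : ∀ {A : Set} {f g : A → Carrier} xs → (∀ x → f x ≈ g x) → sumL f xs ≈ sumL g xs
  sumL-cong List.[]         f≈g = ≈-refl
  sumL-cong (x List.∷ xs) f≈g = +-cong (f≈g x) (sumL-cong xs f≈g)

  sumL-*ʳ : ∀ {A : Set} (f : A → Carrier) k xs → sumL (λ x → f x * k) xs ≈ sumL f xs * k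
  sumL-*ʳ f k List.[]         = ≈-sym (zeroˡ k)
  sumL-*ʳ f k (x List.∷ xs) = ≈-trans (+-cong ≈-refl (sumL-*ʳ f k xs)) (≈-sym (distribʳ k _ _))

  sumL-zero : ∀ {A : Set} (xs : List.List A) → sumL (λ _ → 0#) xs ≈ 0#
  sumL-zero List.[]         = ≈-refl
  sumL-zero (x List.∷ xs) = ≈-trans (+-identityˡ _) (sumL-zero xs)

  sumL-filter : ∀ {A : Set} (p : A → Bool) (f : A → Carrier) xs →
                sumL f (List.filter (λ x → p x Bool.≟ true) xs) ≈ sumL (λ x → if p x then f x else 0#) xs
  sumL-filter p f List.[]         = ≈-refl
  sumL-filter p f (x List.∷ xs) with p x
  ... | true  = +-cong ≈-refl (sumL-filter p f xs)
  ... | false = ≈-trans (sumL-filter p f xs) (≈-sym (+-identityˡ _))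

  sumSubsets : ∀ n → (Subset n → Carrier) → Carrier
  sumSubsets n f = sumL f (allSubsets n)

  sumSubsets-∷ : ∀ n f →
                 sumSubsets (suc n) f ≈ sumSubsets n (f ∘ (true ∷_)) + sumSubsets n (f ∘ (false ∷_))
  sumSubsets-∷ n f = begin
    sumL f (List.map (true ∷_) (allSubsets n) List.++ List.map (false ∷_) (allSubsets n))
      ≈⟨ sumL-++ f (List.map (true ∷_) (allSubsets n)) _ ⟩
    sumL f (List.map (true ∷_) (allSubsets n)) + sumL f (List.map (false ∷_) (allSubsets n))
      ≡⟨ cong₂ _+_ (sumL-map f _ (allSubsets n)) (sumL-map f _ (allSubsets n)) ⟩
    sumSubsets n (f ∘ (true ∷_)) + sumSubsets n (f ∘ (false ∷_)) ∎

  sumSubsets-∷ʳ : ∀ n f →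
                  sumSubsets (suc n) f ≈ sumSubsets n (f ∘ (_∷ʳ true)) + sumSubsets n (f ∘ (_∷ʳ false))
  sumSubsets-∷ʳ zero    f = solve 2 (λ a b → a :+ (b :+ con 0) := (a :+ con 0) :+ (b :+ con 0)) ≈-refl _ _
  sumSubsets-∷ʳ (suc n) f = begin
    sumSubsets (suc (suc n)) f ≈⟨ sumSubsets-∷ (suc n) f ⟩
    sumSubsets (suc n) (f ∘ (true ∷_)) + sumSubsets (suc n) (f ∘ (false ∷_))
      ≈⟨ +-cong (sumSubsets-∷ʳ n _) (sumSubsets-∷ʳ n _) ⟩
    (tt + tf) + (ft + ff)
      ≈⟨ solve 4 (λ a b c d → (a :+ b) :+ (c :+ d) := (a :+ c) :+ (b :+ d)) ≈-refl tt tf ft ff ⟩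
    (tt + ft) + (tf + ff)
      ≈⟨ +-cong (≈-sym (sumSubsets-∷ n _)) (≈-sym (sumSubsets-∷ n _)) ⟩
    sumSubsets (suc n) (f ∘ (_∷ʳ true)) + sumSubsets (suc n) (f ∘ (_∷ʳ false)) ∎
    where
    tt = sumSubsets n (λ X → f (true ∷ (X ∷ʳ true)))
    tf = sumSubsets n (λ X → f (true ∷ (X ∷ʳ false)))
    ft = sumSubsets n (λ X → f (false ∷ (X ∷ʳ true)))
    ff = sumSubsets n (λ X → f (false ∷ (X ∷ʳ false)))

  pow-+ : ∀ x a b → pow x (a +ℕ b) ≈ pow x a * pow x b
  pow-+ x zero    b = ≈-sym (*-identityˡ _)
  pow-+ x (suc a) b = ≈-trans (*-cong ≈-refl (pow-+ x a b)) (≈-sym (*-assoc _ _ _))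

  Z-cong : ∀ {n} (M N : Matroid n) qinv v → (∀ A → Matroid.rk M A ≡ Matroid.rk N A) → Z M qinv v ≈ Z N qinv v
  Z-cong {n} M N qinv v rk≗ =
    sumL-cong (allSubsets n) (λ A → *-cong (reflexive (cong (pow qinv) (rk≗ A))) ≈-refl)

module BasisExpansion {c ℓ : Level} (R : CommutativeRing c ℓ) (q qinv : CommutativeRing.Carrier R) where
  open CommutativeRing R renaming (refl to ≈-refl; sym to ≈-sym; trans to ≈-trans)
  open RingOps R
  open RingSums R
  open import Algebra.Solver.Ring.NaturalCoefficients.Default commutativeSemiring
  open import Relation.Binary.Reasoning.Setoid setoid

  weight : ∀ {n} → Matroid n → (v vinv : Fin n → Carrier) → Subset n → Carrier
  weight N v vinv B =
    prodOver B v * prodOver (E[_] N B) (λ e → v e + 1#) * prodOver (I[_] N B) (λ i → q * vinv i + 1#)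

  basisSum : ∀ {n} → Matroid n → (v vinv : Fin n → Carrier) → Carrier
  basisSum N v vinv = sumL (weight N v vinv) (bases N)

  basisTerm : ∀ {n} → Matroid n → (v vinv : Fin n → Carrier) → Subset n → Carrier
  basisTerm N v vinv B = if isBasis N B then weight N v vinv B else 0#

  basisSum≈sumSubsets : ∀ {n} (N : Matroid n) v vinv → basisSum N v vinv ≈ sumSubsets n (basisTerm N v vinv)
  basisSum≈sumSubsets {n} N v vinv = sumL-filter (isBasis N) (weight N v vinv) (allSubsets n)

  basisTerm-transfer : ∀ {m k} (M : Matroid m) (N : Matroid k) {v vinv u uinv} B′ B c →
                       isBasis M B′ ≡ isBasis N B →
                       (isBasis N B ≡ true → weight M v vinv B′ ≈ weight N u uinv B * c) →
                       basisTerm M v vinv B′ ≈ basisTerm N u uinv B * c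
  basisTerm-transfer M N B′ B c same-status weights rewrite same-status with isBasis N B
  ... | true  = weights refl
  ... | false = ≈-sym (zeroˡ c)

  basisTerm-non-basis : ∀ {m} (M : Matroid m) {v vinv} B → isBasis M B ≡ false → basisTerm M v vinv B ≈ 0#
  basisTerm-non-basis M B not-basis rewrite not-basis = ≈-refl

  Expansion : ∀ {n} → Matroid n → (v vinv : Fin n → Carrier) → Set ℓ
  Expansion N v vinv = Z N qinv v ≈ pow qinv (Matroid.rk N full) * basisSum N v vinv

  module LastElementExpansion {n} (M : Matroid (suc n)) (v vinv : Fin (suc n) → Carrier) where
    open Matroid M
    open LastElement M

    v′ vinv′ : Fin n → Carrier
    v′    = v ∘ inject₁
    vinv′ = vinv ∘ inject₁

    vω : Carrier
    vω = v ω

    lastFactor : Bool → Bool → Bool → Carrier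
    lastFactor b e i = factorIf b vω * factorIf e (vω + 1#) * factorIf i (q * vinv ω + 1#)

    weight-∷ʳ : ∀ (N : Matroid n) (B : Subset n) b →
      (∀ i → extActive M (B ∷ʳ b) (inject₁ i) ≡ extActive N B i) →
      (∀ i → intActive M (B ∷ʳ b) (inject₁ i) ≡ intActive N B i) →
      weight M v vinv (B ∷ʳ b)
        ≈ weight N v′ vinv′ B * lastFactor b (extActive M (B ∷ʳ b) ω) (intActive M (B ∷ʳ b) ω)
    weight-∷ʳ N B b ext≗ int≗ = begin
      prodOver (B ∷ʳ b) v * prodOver (E[_] M (B ∷ʳ b)) f * prodOver (I[_] M (B ∷ʳ b)) g
        ≡⟨ cong₂ (λ E I → prodOver (B ∷ʳ b) v * prodOver E f * prodOver I g) E≡ I≡ ⟩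
      prodOver (B ∷ʳ b) v * prodOver (E[_] N B ∷ʳ xe) f * prodOver (I[_] N B ∷ʳ xi) g
        ≈⟨ *-cong (*-cong (prodOver-∷ʳ B b v) (prodOver-∷ʳ (E[_] N B) xe f)) (prodOver-∷ʳ (I[_] N B) xi g) ⟩
      (p₁ * s₁) * (p₂ * s₂) * (p₃ * s₃)
        ≈⟨ solve 6 (λ p₁ s₁ p₂ s₂ p₃ s₃ → (p₁ :* s₁) :* (p₂ :* s₂) :* (p₃ :* s₃)
                                        := p₁ :* p₂ :* p₃ :* (s₁ :* s₂ :* s₃))
                 ≈-refl p₁ s₁ p₂ s₂ p₃ s₃ ⟩
      (p₁ * p₂ * p₃) * (s₁ * s₂ * s₃) ∎
      where
      f = λ e → v e + 1#
      g = λ i → q * vinv i + 1#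
      xe = extActive M (B ∷ʳ b) ω
      xi = intActive M (B ∷ʳ b) ω
      E≡ : E[_] M (B ∷ʳ b) ≡ E[_] N B ∷ʳ xe
      E≡ = trans (tabulate-∷ʳ n (extActive M (B ∷ʳ b))) (cong (_∷ʳ xe) (tabulate-cong ext≗))
      I≡ : I[_] M (B ∷ʳ b) ≡ I[_] N B ∷ʳ xi
      I≡ = trans (tabulate-∷ʳ n (intActive M (B ∷ʳ b))) (cong (_∷ʳ xi) (tabulate-cong int≗))
      p₁ = prodOver B v′
      p₂ = prodOver (E[_] N B) (f ∘ inject₁)
      p₃ = prodOver (I[_] N B) (g ∘ inject₁)
      s₁ = factorIf b vω
      s₂ = factorIf xe (vω + 1#)
      s₃ = factorIf xi (q * vinv ω + 1#)

    Z-deletion-contraction : Z M qinv v ≈ pow qinv rk-ω * vω * Z contraction qinv v′ + Z deletion qinv v′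
    Z-deletion-contraction = ≈-trans (sumSubsets-∷ʳ n (λ A → pow qinv (rk A) * prodOver A v))
      (+-cong (≈-trans (sumL-cong (allSubsets n) with-ω)
                       (≈-trans (sumL-*ʳ _ _ (allSubsets n)) (*-comm _ _)))
              (sumL-cong (allSubsets n) without-ω))
      where
      with-ω : ∀ A → pow qinv (rk₁ A) * prodOver (A ∷ʳ true) v
                   ≈ (pow qinv (rk₁ A ∸ rk-ω) * prodOver A v′) * (pow qinv rk-ω * vω)
      with-ω A = ≈-trans
        (*-cong (≈-trans (reflexive (cong (pow qinv) (sym (ℕ.m∸n+n≡m (rk-ω≤rk₁ A)))))
                         (pow-+ qinv (rk₁ A ∸ rk-ω) rk-ω))
                (prodOver-∷ʳ A true v))
        (solve 4 (λ a b c d → (a :* b) :* (c :* d) := (a :* c) :* (b :* d)) ≈-refl _ _ _ _)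
      without-ω : ∀ A → pow qinv (rk₀ A) * prodOver (A ∷ʳ false) v ≈ pow qinv (rk₀ A) * prodOver A v′
      without-ω A = *-cong ≈-refl (≈-trans (prodOver-∷ʳ A false v) (*-identityʳ _))

    basisSum-split : basisSum M v vinv ≈ sumSubsets n (λ B → basisTerm M v vinv (B ∷ʳ true))
                                        + sumSubsets n (λ B → basisTerm M v vinv (B ∷ʳ false))
    basisSum-split = ≈-trans (basisSum≈sumSubsets M v vinv) (sumSubsets-∷ʳ n (basisTerm M v vinv))

    weight-∷ʳfalse : rk₀ full ≡ rk₁ full → ∀ B →
      weight M v vinv (B ∷ʳ false) ≈ weight deletion v′ vinv′ B * factorIf (rk-ω ≡ᵇ 0) (vω + 1#)
    weight-∷ʳfalse rk₀≡rk₁ B = begin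
      weight M v vinv (B ∷ʳ false)
        ≈⟨ weight-∷ʳ deletion B false (extActive-∷ʳfalse-inject₁ B)
                     (intActive-∷ʳ-inject₁ deletion false (isBasis-∷ʳfalse rk₀≡rk₁) B) ⟩
      weight deletion v′ vinv′ B * lastFactor false (extActive M (B ∷ʳ false) ω) (intActive M (B ∷ʳ false) ω)
        ≡⟨ cong₂ (λ e i → weight deletion v′ vinv′ B * lastFactor false e i)
                 (extActive-ω B false) (intActive-ω B false) ⟩
      weight deletion v′ vinv′ B * (1# * factorIf (rk-ω ≡ᵇ 0) (vω + 1#) * 1#)
        ≈⟨ *-cong ≈-refl (≈-trans (*-identityʳ _) (*-identityˡ _)) ⟩
      weight deletion v′ vinv′ B * factorIf (rk-ω ≡ᵇ 0) (vω + 1#) ∎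

    weight-∷ʳtrue : rk-ω ≡ 1 → ∀ B →
      weight M v vinv (B ∷ʳ true)
        ≈ weight contraction v′ vinv′ B * (vω * factorIf (intActive M (B ∷ʳ true) ω) (q * vinv ω + 1#))
    weight-∷ʳtrue rk-ω≡1 B = begin
      weight M v vinv (B ∷ʳ true)
        ≈⟨ weight-∷ʳ contraction B true (extActive-∷ʳtrue-inject₁ B)
                     (intActive-∷ʳ-inject₁ contraction true (isBasis-∷ʳtrue rk-ω≡1) B) ⟩
      weight contraction v′ vinv′ B * lastFactor true (extActive M (B ∷ʳ true) ω) (intActive M (B ∷ʳ true) ω)
        ≡⟨ cong (λ e → weight contraction v′ vinv′ B * lastFactor true e (intActive M (B ∷ʳ true) ω))
                (extActive-ω B true) ⟩
      weight contraction v′ vinv′ B * (vω * 1# * factorIf (intActive M (B ∷ʳ true) ω) (q * vinv ω + 1#))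
        ≈⟨ *-cong ≈-refl (*-cong (*-identityʳ vω) ≈-refl) ⟩
      weight contraction v′ vinv′ B * (vω * factorIf (intActive M (B ∷ʳ true) ω) (q * vinv ω + 1#)) ∎

    basisTerm-∷ʳfalse : rk₀ full ≡ rk₁ full → ∀ B →
      basisTerm M v vinv (B ∷ʳ false) ≈ basisTerm deletion v′ vinv′ B * factorIf (rk-ω ≡ᵇ 0) (vω + 1#)
    basisTerm-∷ʳfalse rk₀≡rk₁ B =
      basisTerm-transfer M deletion (B ∷ʳ false) B _ (isBasis-∷ʳfalse rk₀≡rk₁ B) λ _ → weight-∷ʳfalse rk₀≡rk₁ B

    basisTerm-∷ʳtrue-regular : rk-ω ≡ 1 → rk₀ full ≡ rk₁ full → ∀ B →
      basisTerm M v vinv (B ∷ʳ true) ≈ basisTerm contraction v′ vinv′ B * vω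
    basisTerm-∷ʳtrue-regular rk-ω≡1 rk₀≡rk₁ B =
      basisTerm-transfer M contraction (B ∷ʳ true) B vω (isBasis-∷ʳtrue rk-ω≡1 B) λ B-basis →
        ≈-trans (weight-∷ʳtrue rk-ω≡1 B) (*-cong ≈-refl (≈-trans
          (reflexive (cong (λ i → vω * factorIf i (q * vinv ω + 1#))
                           (regular⇒¬intActive-ω rk-ω≡1 rk₀≡rk₁ B B-basis)))
          (*-identityʳ vω)))

    basisTerm-∷ʳtrue-coloop : rk₀ full < rk₁ full → ∀ B →
      basisTerm M v vinv (B ∷ʳ true) ≈ basisTerm contraction v′ vinv′ B * (vω * (q * vinv ω + 1#))
    basisTerm-∷ʳtrue-coloop coloop-ω B =
      basisTerm-transfer M contraction (B ∷ʳ true) B _ (isBasis-∷ʳtrue rk-ω≡1 B) λ _ →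
        ≈-trans (weight-∷ʳtrue rk-ω≡1 B)
          (reflexive (cong (λ i → weight contraction v′ vinv′ B * (vω * factorIf i (q * vinv ω + 1#)))
                            (coloop⇒intActive-ω coloop-ω B)))
      where
      rk-ω≡1 = coloop⇒rk-ω≡1 coloop-ω

    sum-of-scaled-terms : ∀ (N : Matroid n) {f : Subset n → Carrier} c →
                          (∀ B → f B ≈ basisTerm N v′ vinv′ B * c) → sumSubsets n f ≈ basisSum N v′ vinv′ * c
    sum-of-scaled-terms N c f≈ = ≈-trans (sumL-cong (allSubsets n) f≈)
      (≈-trans (sumL-*ʳ _ c (allSubsets n)) (*-cong (≈-sym (basisSum≈sumSubsets N v′ vinv′)) ≈-refl))

    sum-of-non-bases : ∀ b → (∀ (B : Subset n) → isBasis M (B ∷ʳ b) ≡ false) →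
                       sumSubsets n (λ B → basisTerm M v vinv (B ∷ʳ b)) ≈ 0#
    sum-of-non-bases b non-basis =
      ≈-trans (sumL-cong (allSubsets n) (λ B → basisTerm-non-basis M (B ∷ʳ b) (non-basis B)))
              (sumL-zero (allSubsets n))

    basisSum-loop : rk-ω ≡ 0 → basisSum M v vinv ≈ basisSum deletion v′ vinv′ * (vω + 1#)
    basisSum-loop rk-ω≡0 = ≈-trans basisSum-split (≈-trans (+-cong
      (sum-of-non-bases true (loop⇒¬isBasis-∷ʳtrue rk-ω≡0))
      (sum-of-scaled-terms deletion (vω + 1#) λ B → ≈-trans (basisTerm-∷ʳfalse rk₀≡rk₁ B)
        (*-cong ≈-refl (reflexive (cong (λ k → factorIf (k ≡ᵇ 0) (vω + 1#)) rk-ω≡0)))))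
      (+-identityˡ _))
      where
      rk₀≡rk₁ = sym (loop⇒rk₁≡rk₀ rk-ω≡0 full)

    basisSum-regular : rk-ω ≡ 1 → rk₀ full ≡ rk₁ full →
                       basisSum M v vinv ≈ basisSum contraction v′ vinv′ * vω + basisSum deletion v′ vinv′
    basisSum-regular rk-ω≡1 rk₀≡rk₁ = ≈-trans basisSum-split (+-cong
      (sum-of-scaled-terms contraction vω (basisTerm-∷ʳtrue-regular rk-ω≡1 rk₀≡rk₁))
      (≈-trans (sum-of-scaled-terms deletion 1# λ B → ≈-trans (basisTerm-∷ʳfalse rk₀≡rk₁ B)
                 (*-cong ≈-refl (reflexive (cong (λ k → factorIf (k ≡ᵇ 0) (vω + 1#)) rk-ω≡1))))
               (*-identityʳ _)))

    basisSum-coloop : rk₀ full < rk₁ full →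
                      basisSum M v vinv ≈ basisSum contraction v′ vinv′ * (vω * (q * vinv ω + 1#))
    basisSum-coloop coloop-ω = ≈-trans basisSum-split (≈-trans (+-cong
      (sum-of-scaled-terms contraction _ (basisTerm-∷ʳtrue-coloop coloop-ω))
      (sum-of-non-bases false (coloop⇒¬isBasis-∷ʳfalse coloop-ω)))
      (+-identityʳ _))

    expansion-loop : rk-ω ≡ 0 → Expansion deletion v′ vinv′ → Expansion M v vinv
    expansion-loop rk-ω≡0 IH = begin
      Z M qinv v ≈⟨ Z-deletion-contraction ⟩
      pow qinv rk-ω * vω * Z contraction qinv v′ + Z deletion qinv v′
        ≈⟨ +-cong (*-cong (*-cong (reflexive (cong (pow qinv) rk-ω≡0)) ≈-refl)
                          (Z-cong contraction deletion qinv v′ (loop⇒contraction≗deletion rk-ω≡0))) ≈-refl ⟩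
      1# * vω * Z deletion qinv v′ + Z deletion qinv v′ ≈⟨ +-cong (*-cong ≈-refl IH) IH ⟩
      1# * vω * (P * S) + P * S
        ≈⟨ solve 3 (λ w p s → con 1 :* w :* (p :* s) :+ p :* s := p :* (s :* (w :+ con 1))) ≈-refl vω P S ⟩
      P * (S * (vω + 1#))
        ≈⟨ *-cong (reflexive (cong (pow qinv) rk₀≡rk)) (≈-sym (basisSum-loop rk-ω≡0)) ⟩
      pow qinv (rk full) * basisSum M v vinv ∎
      where
      P = pow qinv (rk₀ full)
      S = basisSum deletion v′ vinv′
      rk₀≡rk : rk₀ full ≡ rk full
      rk₀≡rk = trans (sym (loop⇒rk₁≡rk₀ rk-ω≡0 full)) (sym rk-full)

    expansion-regular : rk-ω ≡ 1 → rk₀ full ≡ rk₁ full →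
                        Expansion contraction v′ vinv′ → Expansion deletion v′ vinv′ → Expansion M v vinv
    expansion-regular rk-ω≡1 rk₀≡rk₁ IHc IHd = begin
      Z M qinv v ≈⟨ Z-deletion-contraction ⟩
      pow qinv rk-ω * vω * Z contraction qinv v′ + Z deletion qinv v′
        ≈⟨ +-cong (*-cong (*-cong (reflexive (cong (pow qinv) rk-ω≡1)) ≈-refl) IHc) IHd ⟩
      qinv * 1# * vω * (P * Sc) + pow qinv (rk₀ full) * Sd
        ≡⟨ cong (λ k → qinv * 1# * vω * (P * Sc) + pow qinv k * Sd) rk₀≡1+rkc ⟩
      qinv * 1# * vω * (P * Sc) + qinv * P * Sd
        ≈⟨ solve 5 (λ x w p s t → x :* con 1 :* w :* (p :* s) :+ x :* p :* t := x :* p :* (s :* w :+ t))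
                 ≈-refl qinv vω P Sc Sd ⟩
      qinv * P * (Sc * vω + Sd)
        ≈⟨ *-cong (reflexive (cong (pow qinv) (sym (rk-full≡1+rk-contraction rk-ω≡1))))
                  (≈-sym (basisSum-regular rk-ω≡1 rk₀≡rk₁)) ⟩
      pow qinv (rk full) * basisSum M v vinv ∎
      where
      P  = pow qinv (Matroid.rk contraction full)
      Sc = basisSum contraction v′ vinv′
      Sd = basisSum deletion v′ vinv′
      rk₀≡1+rkc : rk₀ full ≡ suc (Matroid.rk contraction full)
      rk₀≡1+rkc = trans rk₀≡rk₁ (trans (sym rk-full) (rk-full≡1+rk-contraction rk-ω≡1))

    -- The only use of invertibility: v_ω (q/v_ω + 1) = q + v_ω and q⁻¹ (q + v_ω) = 1 + q⁻¹ v_ω.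
    expansion-coloop : rk₀ full < rk₁ full → q * qinv ≈ 1# → vω * vinv ω ≈ 1# →
                       Expansion contraction v′ vinv′ → Expansion M v vinv
    expansion-coloop coloop-ω q*qinv≈1 vω*vinvω≈1 IH = begin
      Z M qinv v ≈⟨ Z-deletion-contraction ⟩
      pow qinv rk-ω * vω * Z contraction qinv v′ + Z deletion qinv v′
        ≈⟨ +-cong (*-cong (*-cong (reflexive (cong (pow qinv) rk-ω≡1)) ≈-refl) IH)
                  (≈-trans (Z-cong deletion contraction qinv v′ (sym ∘ coloop⇒contraction≗deletion coloop-ω))
                           IH) ⟩
      qinv * 1# * vω * (P * S) + P * S
        ≈⟨ +-cong ≈-refl (≈-sym (≈-trans (*-cong (*-cong q*qinv≈1 vω*vinvω≈1) ≈-refl)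
                                           (≈-trans (*-cong (*-identityˡ 1#) ≈-refl) (*-identityˡ _)))) ⟩
      qinv * 1# * vω * (P * S) + q * qinv * (vω * vinv ω) * (P * S)
        ≈⟨ solve 6 (λ x y w u p s → x :* con 1 :* w :* (p :* s) :+ y :* x :* (w :* u) :* (p :* s)
                                    := x :* p :* (s :* (w :* (y :* u :+ con 1)))) ≈-refl qinv q vω (vinv ω) P S ⟩
      qinv * P * (S * (vω * (q * vinv ω + 1#)))
        ≈⟨ *-cong (reflexive (cong (pow qinv) (sym (rk-full≡1+rk-contraction rk-ω≡1))))
                  (≈-sym (basisSum-coloop coloop-ω)) ⟩
      pow qinv (rk full) * basisSum M v vinv ∎
      where
      rk-ω≡1 = coloop⇒rk-ω≡1 coloop-ω
      P = pow qinv (Matroid.rk contraction full)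
      S = basisSum contraction v′ vinv′

  expansion : q * qinv ≈ 1# → ∀ n (M : Matroid n) (v vinv : Fin n → Carrier) →
              (∀ e → v e * vinv e ≈ 1#) → Expansion M v vinv
  expansion q*qinv≈1 zero M v vinv _ =
    ≈-trans empty (*-cong ≈-refl (≈-sym (basisSum≈sumSubsets M v vinv)))
    where
    empty : Z M qinv v ≈ pow qinv (Matroid.rk M []) * sumSubsets 0 (basisTerm M v vinv)
    empty rewrite MatroidProperties.rk-∅ M =
      solve 0 (con 1 :* con 1 :+ con 0 := con 1 :* (con 1 :* con 1 :* con 1 :+ con 0)) ≈-refl
  expansion q*qinv≈1 (suc n) M v vinv v*vinv≈1 = by-kind kind
    where
    open LastElement M
    open LastElementExpansion M v vinv
    IH : ∀ N → Expansion N v′ vinv′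
    IH N = expansion q*qinv≈1 n N v′ vinv′ (v*vinv≈1 ∘ inject₁)
    by-kind : Kind → Expansion M v vinv
    by-kind (loop rk-ω≡0)             = expansion-loop rk-ω≡0 (IH deletion)
    by-kind (coloop coloop-ω)         = expansion-coloop coloop-ω q*qinv≈1 (v*vinv≈1 ω) (IH contraction)
    by-kind (regular rk-ω≡1 rk₀≡rk₁) = expansion-regular rk-ω≡1 rk₀≡rk₁ (IH contraction) (IH deletion)

corollary4p7 : {c ℓ : Level} (R : CommutativeRing c ℓ) {n : ℕ} (M : Matroid n)
  (q qinv : CommutativeRing.Carrier R) (v vinv : Fin n → CommutativeRing.Carrier R) →
  CommutativeRing._≈_ R (CommutativeRing._*_ R q qinv) (CommutativeRing.1# R) →
  (∀ e → CommutativeRing._≈_ R (CommutativeRing._*_ R (v e) (vinv e)) (CommutativeRing.1# R)) →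
  let open CommutativeRing R
      open RingOps R
  in
  Z M qinv v ≈
    pow qinv (Matroid.rk M full) *
      sumL (λ B → prodOver B v
                  * prodOver (E[_] M B) (λ e → v e + 1#)
                  * prodOver (I[_] M B) (λ i → q * vinv i + 1#))
           (bases M)
corollary4p7 R {n} M q qinv v vinv q*qinv≈1 v*vinv≈1 =
  BasisExpansion.expansion R q qinv q*qinv≈1 n M v vinv v*vinv≈1
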